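{- Let $(\Gamma,X,\mathcal B)\in\mathcal G$. Let $\mathcal S=\{\mathfrak s(B,\Gamma_{\mathcal B}(\mathfrak v)):B\in\mathcal B,\mathfrak v\in B\}$. Then $\mathcal S$ is an $X$-symmetric orbit on $St^r(\Gamma_{\mathcal B})$, where $r=|\Gamma_{\mathcal B}(\mathfrak v)|$ is constant. Let $$\Theta=\{(\mathfrak l,\mathfrak r):\mathfrak l=\mathfrak s(B,\Gamma_{\mathcal B}(\mathfrak v)),\ \mathfrak r=\mathfrak s(C,\Gamma_{\mathcal B}(\mathfrak u)),\ \mathfrak v\in B\in\mathcal B,\ \mathfrak u\in C\in\mathcal B,\ (\mathfrak v,\mathfrak u)\in Arc(\Gamma)\}.$$ Then $\Theta$ is a self-paired $X$-symmetric orbit on $DSt^r(\Gamma_{\mathcal B})$ with $St(\Theta)=\mathcal S$ and $\Gamma_{\underline{\mathcal B}}\cong\Pi(\Gamma_{\mathcal B},\Theta)$, and $X$ acts faithfully on $\mathcal B$ if and only if $X$ acts faithfully on $\underline{\mathcal B}$.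
   Context: Graphs are finite, simple, undirected; an arc is an ordered pair of adjacent vertices. $X$-symmetric: $X$ acts preserving adjacency, transitively on vertices and arcs. For an $X$-invariant partition $\mathcal B$ of $V(\Gamma)$: $\Gamma_{\mathcal B}$ is the quotient graph on $\mathcal B$ ($B\sim C$ iff some vertex of $B$ is adjacent to some vertex of $C$); $\Gamma(C)=\bigcup_{\mathfrak u\in C}\Gamma(\mathfrak u)$; $\Gamma_{\mathcal B}(\mathfrak v)=\{C\in\mathcal B:\mathfrak v\in\Gamma(C)\}$ (a subset of the neighbourhood of the block containing $\mathfrak v$ in $\Gamma_{\mathcal B}$); $\Gamma$ is a multicover of $\Gamma_{\mathcal B}$ if $|\Gamma(C)\cap B|=|B|$ for adjacent $B,C$. $\mathcal G$ is the set of triples $(\Gamma,X,\mathcal B)$ with $\Gamma$ finite $X$-symmetric, $\mathcal B$ an $X$-invariant partition with $1<|B|<|V(\Gamma)|$, $val(\Gamma_{\mathcal B})\ge2$, $\Gamma$ not a multicover of $\Gamma_{\mathcal B}$. For $\mathfrak v\in B\in\mathcal B$, $B_{\mathfrak v}=B\cap\bigcap_{C\in\Gamma_{\mathcal B}(\mathfrak v)}\Gamma(C)$, and $\underline{\mathcal B}=\{B_{\mathfrak v}:B\in\mathcal B,\mathfrak v\in B\}$ (an $X$-invariant partition of $V(\Gamma)$); $\Gamma_{\underline{\mathcal B}}$ is the corresponding quotient graph. For a graph $\Sigma$ and $S\subseteq\Sigma(\tau)$ with $|S|=\kappa$, the $\kappa$-star is $\mathfrak s(\tau,S)=\{(\tau,\sigma):\sigma\in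 S\}$; $St^\kappa(\Sigma)$ is the set of $\kappa$-stars. A star $\mathfrak s(\tau,S)$ is symmetric if $X_\tau\cap X_S$ is transitive on $S$; a set of stars is $X$-symmetric if it is a single $X$-orbit containing a symmetric star. A $\kappa$-double star is a pair $(\mathfrak l,\mathfrak r)$ of $\kappa$-stars $\mathfrak l=\mathfrak s(\tau,L)$, $\mathfrak r=\mathfrak s(\sigma,R)$ with $\sigma\in L$, $\tau\in R$; $DSt^\kappa(\Sigma)$ is their set; $St(\Theta)=\{\mathfrak l,\mathfrak r:(\mathfrak l,\mathfrak r)\in\Theta\}$; an $X$-orbit $\Theta$ on $DSt^\kappa(\Sigma)$ is $X$-symmetric if $St(\Theta)$ is, and self-paired if $(\mathfrak l,\mathfrak r)\in\Theta\Rightarrow(\mathfrak r,\mathfrak l)\in\Theta$. $\Pi(\Sigma,\Theta)$ is the graph with vertex set $St(\Theta)$ in which $\mathfrak l\sim\mathfrak r$ iff $(\mathfrak l,\mathfrak r)\in\Theta$. -}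

module Defs where

open import Level using (Level; _⊔_)
open import Algebra.Bundles using (Group)
open import Data.Nat using (ℕ; _<_; _≤_)
open import Data.Fin using (Fin; _≟_)
open import Data.Fin.Subset using (Subset; _∈_; _⊆_; ∣_∣; _∩_)
open import Data.Fin.Properties using (any?; all?)
open import Data.Bool using (Bool; true; false; T; not; _∨_)
open import Data.Vec using (tabulate; lookup)
open import Data.Product using (Σ; ∃; _×_; _,_; proj₁)
open import Data.Sum using (_⊎_)
open import Relation.Nullary using (¬_)
open import Relation.Nullary.Decidable using (⌊_⌋; _×-dec_; T?)
open import Relation.Binary.PropositionalEquality using (_≡_)
open import Function.Bundles using (_⇔_)

record Graph (n : ℕ) : Set where
  field
    E      : Fin n → Fin n → Bool
    E-sym  : ∀ u v → E u v ≡ E v u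
    E-irr  : ∀ v → E v v ≡ false

record Action {c ℓ : Level} (X : Group c ℓ) (n : ℕ) : Set (c ⊔ ℓ) where
  open Group X
  field
    act   : Carrier → Fin n → Fin n
    act-ε : ∀ v → act ε v ≡ v
    act-∙ : ∀ g h v → act (g ∙ h) v ≡ act g (act h v)
    act-≈ : ∀ {g h} → g ≈ h → ∀ v → act g v ≡ act h v

-- A partition of Fin n into m (nonempty) blocks, given by labelling each
-- vertex with its block; every label is used (rep i lies in block i).
record Partition (n m : ℕ) : Set where
  field
    blk     : Fin n → Fin m
    rep     : Fin m → Fin n
    blk-rep : ∀ i → blk (rep i) ≡ i

-- Graphs whose vertex set is a setoid (vertices = equivalence classes).
record SGraph : Set₁ where
  field
    V   : Set
    _≈_ : V → V → Set
    _∼_ : V → V → Set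

record Iso (G H : SGraph) : Set where
  private
    module G = SGraph G
    module H = SGraph H
  field
    f     : G.V → H.V
    f-≈   : ∀ {x y} → x G.≈ y → f x H.≈ f y
    f-inj : ∀ {x y} → f x H.≈ f y → x G.≈ y
    f-sur : ∀ b → ∃ λ a → f a H.≈ b
    f-∼   : ∀ x y → (x G.∼ y) ⇔ (f x H.∼ f y)

module Setup {c ℓ : Level} {n m : ℕ} (Γ : Graph n) (X : Group c ℓ)
             (A : Action X n) (P : Partition n m) where
  open Graph Γ
  open Group X
  open Action A
  open Partition P

  Adj : Fin n → Fin n → Set
  Adj u v = T (E u v)

  PreservesAdj : Set c
  PreservesAdj = ∀ g u v → Adj u v → Adj (act g u) (act g v)

  VertexTransitive : Set c
  VertexTransitive = ∀ u v → ∃ λ g → act g u ≡ v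

  ArcTransitive : Set c
  ArcTransitive = ∀ u v u' v' → Adj u v → Adj u' v' →
                  ∃ λ g → act g u ≡ u' × act g v ≡ v'

  Invariant : Set c
  Invariant = ∀ g u v → blk u ≡ blk v → blk (act g u) ≡ blk (act g v)

  block : Fin m → Subset n
  block i = tabulate (λ v → ⌊ blk v ≟ i ⌋)

  Γblk : Fin m → Subset n
  Γblk j = tabulate (λ v → ⌊ any? (λ u → (blk u ≟ j) ×-dec T? (E v u)) ⌋)

  QAdj : Fin m → Fin m → Bool
  QAdj i j = ⌊ any? (λ u → any? (λ w → (blk u ≟ i) ×-dec ((blk w ≟ j) ×-dec T? (E u w)))) ⌋

  QN : Fin m → Subset m
  QN i = tabulate (QAdj i)

  ΓB : Fin n → Subset m
  ΓB v = tabulate (λ j → lookup (Γblk j) v)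

  -- B_v = B ∩ ⋂_{C ∈ Γ_B(v)} Γ(C), where B is the block containing v
  Bsub : Fin n → Subset n
  Bsub v = block (blk v) ∩
           tabulate (λ w → ⌊ all? (λ j → T? (not (lookup (ΓB v) j) ∨ lookup (Γblk j) w)) ⌋)

  Multicover : Set
  Multicover = ∀ i j → T (QAdj i j) → ∣ Γblk j ∩ block i ∣ ≡ ∣ block i ∣

  record InG : Set (c ⊔ ℓ) where
    field
      preserves    : PreservesAdj
      vtrans       : VertexTransitive
      arctrans     : ArcTransitive
      invariant    : Invariant
      blockSize>1  : ∀ i → 1 < ∣ block i ∣
      blockSize<n  : ∀ i → ∣ block i ∣ < n
      val≥2        : ∀ i → 2 ≤ ∣ QN i ∣
      notMulticover : ¬ Multicover

  bact : Carrier → Fin m → Fin m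
  bact g i = blk (act g (rep i))

  bimg : Carrier → Subset m → Subset m
  bimg g S = tabulate (λ j → ⌊ any? (λ i → T? (lookup S i) ×-dec (bact g i ≟ j)) ⌋)

  vimg : Carrier → Subset n → Subset n
  vimg g S = tabulate (λ w → ⌊ any? (λ v → T? (lookup S v) ×-dec (act g v ≟ w)) ⌋)

  Star : Set
  Star = Fin m × Subset m

  sact : Carrier → Star → Star
  sact g (τ , S) = (bact g τ , bimg g S)

  IsStar : ℕ → Star → Set
  IsStar κ (τ , S) = S ⊆ QN τ × ∣ S ∣ ≡ κ

  DStar : Set
  DStar = Star × Star

  dact : Carrier → DStar → DStar
  dact g (l , r) = (sact g l , sact g r)

  IsDStar : ℕ → DStar → Set
  IsDStar κ ((τ , L) , (σ , R)) = IsStar κ (τ , L) × IsStar κ (σ , R) × σ ∈ L × τ ∈ R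

  IsOrbitOn : {T : Set} → (Carrier → T → T) → (T → Set) → (T → Set) → Set c
  IsOrbitOn {T} α U Q =
    (∀ t → Q t → U t) ×
    (∃ λ t → Q t) ×
    (∀ g t → Q t → Q (α g t)) ×
    (∀ s t → Q s → Q t → ∃ λ g → α g s ≡ t)

  SymmetricStar : Star → Set c
  SymmetricStar (τ , S) = ∀ σ σ' → σ ∈ S → σ' ∈ S →
    ∃ λ g → bact g τ ≡ τ × bimg g S ≡ S × bact g σ ≡ σ'

  XSymStars : ℕ → (Star → Set) → Set c
  XSymStars κ Q = IsOrbitOn sact (IsStar κ) Q × (∃ λ s → Q s × SymmetricStar s)

  StOf : (DStar → Set) → Star → Set
  StOf Θ s = ∃ λ t → Θ (s , t) ⊎ Θ (t , s)

  XSymDOrbit : ℕ → (DStar → Set) → Set c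
  XSymDOrbit κ Θ = IsOrbitOn dact (IsDStar κ) Θ × XSymStars κ (StOf Θ)

  SelfPaired : (DStar → Set) → Set
  SelfPaired Θ = ∀ l r → Θ (l , r) → Θ (r , l)

  ΠGraph : (DStar → Set) → SGraph
  ΠGraph Θ = record
    { V   = Σ Star (StOf Θ)
    ; _≈_ = λ a b → proj₁ a ≡ proj₁ b
    ; _∼_ = λ a b → Θ (proj₁ a , proj₁ b)
    }

  -- Γ_{underline B}: vertices are the blocks B_v (v identified with w iff B_v = B_w)
  ΓuB : SGraph
  ΓuB = record
    { V   = Fin n
    ; _≈_ = λ v w → Bsub v ≡ Bsub w
    ; _∼_ = λ v w → ∃ λ x → ∃ λ y → x ∈ Bsub v × y ∈ Bsub w × Adj x y
    }

  𝓢 : Star → Set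
  𝓢 s = ∃ λ v → s ≡ (blk v , ΓB v)

  Θ₀ : DStar → Set
  Θ₀ (l , r) = ∃ λ v → ∃ λ u → Adj v u × l ≡ (blk v , ΓB v) × r ≡ (blk u , ΓB u)

  FaithfulOnB : Set (c ⊔ ℓ)
  FaithfulOnB = ∀ g → (∀ i → bact g i ≡ i) → g ≈ ε

  FaithfulOnUB : Set (c ⊔ ℓ)
  FaithfulOnUB = ∀ g → (∀ v → vimg g (Bsub v) ≡ Bsub v) → g ≈ ε

module Submission where

-- Theorem 3.7 concerns the map  v ↦ 𝔰(B, Γ_B(v))  sending a vertex v in
-- block B to its star  starOf v  in the quotient graph Γ_B.  The proof rests
-- on three facts about this map.
--  (1) It is X-equivariant:  sact g (starOf v) ≡ starOf (g v)  (the partition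
--      is X-invariant and X preserves adjacency).
--  (2) Hence the size |Γ_B(v)| is invariant under X (an action permutes the
--      blocks), and so constant by vertex-transitivity.
--  (3) B_v is exactly the fibre  { w : starOf w ≡ starOf v }: for w ∈ B_v one
--      only knows Γ_B(v) ⊆ Γ_B(w) a priori, and (2) upgrades it to equality.
-- The theorem then follows: 𝓢 is the image of starOf and Θ is the image of
-- the arcs, so vertex- and arc-transitivity make them symmetric orbits; (3)
-- identifies the vertices of Γ_{B̲} with the stars in 𝓢, giving the
-- isomorphism with Π(Γ_B, Θ); and g fixes every block iff it fixes every
-- star, iff it fixes every fibre of starOf, i.e. every block of B̲.

open import Defs
open import Level using (Level)
open import Algebra.Bundles using (Group)
open import Data.Nat using (ℕ; zero; suc; _<_; s≤s; z≤n)
import Data.Nat.Properties as ℕ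
open import Data.Fin using (Fin; zero)
open import Data.Fin.Subset using (Subset; _∈_; _⊆_; ∣_∣; Nonempty)
open import Data.Fin.Subset.Properties
  using (⊆-antisym; p⊂q⇒∣p∣<∣q∣; x∈p∩q⁺; x∈p∩q⁻; nonempty?; Empty-unique; ∣⊥∣≡0)
  renaming (_∈?_ to _∈ˢ?_)
open import Data.Fin.Permutation using (Permutation′; permutation; _⟨$⟩ʳ_)
open import Data.Bool using (Bool; true; false; T; not; _∨_)
open import Data.Bool.Properties using (T-≡; ⇔→≡)
open import Data.Vec using ([]; _∷_; tabulate; lookup)
open import Data.Vec.Properties using (lookup∘tabulate; []=↔lookup)
open import Data.Product using (Σ; ∃; _×_; _,_; proj₁; proj₂)
open import Data.Sum using (inj₁; inj₂)
open import Data.Empty using (⊥-elim)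
open import Relation.Nullary using (¬_; yes; no)
open import Relation.Nullary.Decidable using (⌊_⌋; toWitness; fromWitness)
open import Relation.Unary using (Decidable)
open import Relation.Binary.PropositionalEquality
open import Function.Bundles using (_⇔_; mk⇔; Equivalence)
open import Function.Properties.Equivalence using () renaming (trans to ⇔-trans; sym to ⇔-sym)
open import Function.Properties.Inverse using (↔⇒⇔)
open import Algebra.Properties.CommutativeMonoid.Sum ℕ.+-0-commutativeMonoid
  using (sum; sum-permute; sum-cong-≗)

open Equivalence using (to; from)

∈⇔lookup : ∀ {n} {S : Subset n} {i} → i ∈ S ⇔ T (lookup S i)
∈⇔lookup = ⇔-trans (↔⇒⇔ []=↔lookup) (⇔-sym T-≡)

∈-tabulate : ∀ {n} (f : Fin n → Bool) {i} → i ∈ tabulate f ⇔ T (f i)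
∈-tabulate f {i} = subst (λ b → i ∈ tabulate f ⇔ T b) (lookup∘tabulate f i) ∈⇔lookup

∈-filter : ∀ {n p} {P : Fin n → Set p} (P? : Decidable P) {i} →
           i ∈ tabulate (λ j → ⌊ P? j ⌋) ⇔ P i
∈-filter P? = ⇔-trans (∈-tabulate _) (mk⇔ toWitness fromWitness)

T-implication : ∀ {a b} → T (not a ∨ b) ⇔ (T a → T b)
T-implication {true}  = mk⇔ (λ t _ → t) (λ f → f _)
T-implication {false} = mk⇔ (λ _ ()) (λ _ → _)

⊆-same-size : ∀ {n} {p q : Subset n} → p ⊆ q → ∣ p ∣ ≡ ∣ q ∣ → p ≡ q
⊆-same-size {p = p} {q} p⊆q same = ⊆-antisym p⊆q q⊆p
  where
  q⊆p : q ⊆ p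
  q⊆p {x} x∈q with x ∈ˢ? p
  ... | yes x∈p = x∈p
  ... | no  x∉p = ⊥-elim (ℕ.<⇒≢ (p⊂q⇒∣p∣<∣q∣ (p⊆q , x , x∈q , x∉p)) same)

nonempty-of-size : ∀ {n} (p : Subset n) → 0 < ∣ p ∣ → Nonempty p
nonempty-of-size {n} p 0<∣p∣ with nonempty? p
... | yes ne = ne
... | no  empty = ⊥-elim (ℕ.<⇒≢ 0<∣p∣
                    (sym (trans (cong ∣_∣ (Empty-unique empty)) (∣⊥∣≡0 n))))

indicator : Bool → ℕ
indicator true  = 1
indicator false = 0

size-as-sum : ∀ {n} (p : Subset n) → ∣ p ∣ ≡ sum (λ i → indicator (lookup p i))
size-as-sum []          = refl
size-as-sum (true  ∷ p) = cong suc (size-as-sum p)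
size-as-sum (false ∷ p) = size-as-sum p

size-permute : ∀ {m} (π : Permutation′ m) (S T′ : Subset m) →
               (∀ i → i ∈ S ⇔ π ⟨$⟩ʳ i ∈ T′) → ∣ S ∣ ≡ ∣ T′ ∣
size-permute π S T′ corr = begin
  ∣ S ∣                                          ≡⟨ size-as-sum S ⟩
  sum (λ i → indicator (lookup S i))             ≡⟨ sum-cong-≗ (λ i → cong indicator (lookups i)) ⟩
  sum (λ i → indicator (lookup T′ (π ⟨$⟩ʳ i)))   ≡⟨ sum-permute (λ j → indicator (lookup T′ j)) π ⟨
  sum (λ j → indicator (lookup T′ j))            ≡⟨ size-as-sum T′ ⟨
  ∣ T′ ∣                                         ∎
  where
  open ≡-Reasoning
  lookups : ∀ i → lookup S i ≡ lookup T′ (π ⟨$⟩ʳ i)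
  lookups i = ⇔→≡ (⇔-trans (⇔-sym (↔⇒⇔ []=↔lookup)) (⇔-trans (corr i) (↔⇒⇔ []=↔lookup)))

inhabited-of-refuted : ∀ {m p} {P : Fin m → Set p} → ¬ (∀ i → P i) → Fin m
inhabited-of-refuted {zero}  refuted = ⊥-elim (refuted (λ ()))
inhabited-of-refuted {suc m} _       = zero

module ActionLaws {c ℓ} {X : Group c ℓ} {n} (A : Action X n) where
  open Group X using (_∙_; _⁻¹; ε; _≈_; inverseˡ; inverseʳ)
  open Action A

  act-cancel : ∀ {g h} → h ∙ g ≈ ε → ∀ v → act h (act g v) ≡ v
  act-cancel {g} {h} hg≈ε v = trans (sym (act-∙ h g v)) (trans (act-≈ hg≈ε v) (act-ε v))

  act-inverseˡ : ∀ g v → act (g ⁻¹) (act g v) ≡ v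
  act-inverseˡ g = act-cancel (inverseˡ g)

  act-inverseʳ : ∀ g v → act g (act (g ⁻¹) v) ≡ v
  act-inverseʳ g = act-cancel (inverseʳ g)

module Theory {c ℓ} {n m} (Γ : Graph n) (X : Group c ℓ) (A : Action X n) (P : Partition n m) where
  open Setup Γ X A P
  open Graph Γ
  open Group X using (Carrier; _⁻¹)
  open Action A
  open Partition P
  open ActionLaws A

  starOf : Fin n → Star
  starOf v = (blk v , ΓB v)

  adj-sym : ∀ {u v} → Adj u v → Adj v u
  adj-sym {u} {v} = subst T (E-sym u v)

  ∈-block : ∀ {i v} → v ∈ block i ⇔ blk v ≡ i
  ∈-block = ∈-filter _

  ∈-Γblk : ∀ {j v} → v ∈ Γblk j ⇔ (∃ λ u → blk u ≡ j × Adj v u)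
  ∈-Γblk = ∈-filter _

  ∈-ΓB : ∀ {v j} → j ∈ ΓB v ⇔ (∃ λ u → blk u ≡ j × Adj v u)
  ∈-ΓB = ⇔-trans (∈-tabulate _) (⇔-trans (⇔-sym ∈⇔lookup) ∈-Γblk)

  ∈-QN : ∀ {i j} → j ∈ QN i ⇔ (∃ λ u → ∃ λ w → blk u ≡ i × blk w ≡ j × Adj u w)
  ∈-QN = ⇔-trans (∈-tabulate _) (mk⇔ toWitness fromWitness)

  ∈-Bsub : ∀ {v w} → w ∈ Bsub v ⇔ (blk w ≡ blk v × ΓB v ⊆ ΓB w)
  ∈-Bsub {v} {w} = mk⇔
    (λ w∈ → let (inB , inCap) = x∈p∩q⁻ _ _ w∈ in
            to ∈-block inB , λ {j} j∈ → coverage-to (to (∈-filter _) inCap) j∈)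
    (λ (sameBlk , ⊆ΓB) →
       x∈p∩q⁺ (from ∈-block sameBlk , from (∈-filter _) (coverage-from (λ {j} → ⊆ΓB {j}))))
    where
    -- the second factor of B_v says: w ∈ Γ(C) for every C ∈ Γ_B(v)
    Coverage : Set
    Coverage = ∀ j → T (not (lookup (ΓB v) j) ∨ lookup (Γblk j) w)

    via-lookup : ∀ {j} → T (lookup (Γblk j) w) ⇔ j ∈ ΓB w
    via-lookup = ⇔-trans (⇔-sym ∈⇔lookup) (⇔-trans ∈-Γblk (⇔-sym ∈-ΓB))

    coverage-to : Coverage → ΓB v ⊆ ΓB w
    coverage-to cov {j} j∈ = to via-lookup (to T-implication (cov j) (to ∈⇔lookup j∈))

    coverage-from : ΓB v ⊆ ΓB w → Coverage
    coverage-from ⊆ΓB j = from T-implication (λ t → from via-lookup (⊆ΓB (from ∈⇔lookup t)))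

  ∈-bimg : ∀ {g S j} → j ∈ bimg g S ⇔ (∃ λ i → i ∈ S × bact g i ≡ j)
  ∈-bimg {S = S} = ⇔-trans (∈-filter _) (mk⇔ (λ (i , t , e) → i , from ∈⇔lookup t , e)
                                             (λ (i , i∈ , e) → i , to ∈⇔lookup i∈ , e))

  ∈-vimg : ∀ {g S w} → w ∈ vimg g S ⇔ (∃ λ v → v ∈ S × act g v ≡ w)
  ∈-vimg {S = S} = ⇔-trans (∈-filter _) (mk⇔ (λ (v , t , e) → v , from ∈⇔lookup t , e)
                                             (λ (v , v∈ , e) → v , to ∈⇔lookup v∈ , e))

  ΓB⊆QN : ∀ v → ΓB v ⊆ QN (blk v)
  ΓB⊆QN v j∈ = let (u , blk-u , adj) = to ∈-ΓB j∈ in from ∈-QN (v , u , refl , blk-u , adj)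

  XSymStars-cong : ∀ {κ} {Q Q′ : Star → Set} →
                   (∀ s → Q s ⇔ Q′ s) → XSymStars κ Q → XSymStars κ Q′
  XSymStars-cong Q⇔Q′ ((stars , (t , qt) , closed , transitive) , (s , qs , symmetric)) =
    ( (λ t q → stars t (from (Q⇔Q′ t) q))
    , (t , to (Q⇔Q′ t) qt)
    , (λ g t q → to (Q⇔Q′ _) (closed g t (from (Q⇔Q′ t) q)))
    , (λ s t q q′ → transitive s t (from (Q⇔Q′ s) q) (from (Q⇔Q′ t) q′)) )
    , (s , to (Q⇔Q′ s) qs , symmetric)

  module Equivariance (preserves : PreservesAdj) (invariant : Invariant) where

    blk-act : ∀ g v → bact g (blk v) ≡ blk (act g v)
    blk-act g v = invariant g (rep (blk v)) v (blk-rep (blk v))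

    bact-inverseˡ : ∀ g j → bact (g ⁻¹) (bact g j) ≡ j
    bact-inverseˡ g j = begin
      bact (g ⁻¹) (blk (act g (rep j)))  ≡⟨ blk-act (g ⁻¹) (act g (rep j)) ⟩
      blk (act (g ⁻¹) (act g (rep j)))   ≡⟨ cong blk (act-inverseˡ g (rep j)) ⟩
      blk (rep j)                        ≡⟨ blk-rep j ⟩
      j                                  ∎
      where open ≡-Reasoning

    bact-inverseʳ : ∀ g j → bact g (bact (g ⁻¹) j) ≡ j
    bact-inverseʳ g j = begin
      bact g (blk (act (g ⁻¹) (rep j)))  ≡⟨ blk-act g (act (g ⁻¹) (rep j)) ⟩
      blk (act g (act (g ⁻¹) (rep j)))   ≡⟨ cong blk (act-inverseʳ g (rep j)) ⟩
      blk (rep j)                        ≡⟨ blk-rep j ⟩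
      j                                  ∎
      where open ≡-Reasoning

    bperm : Carrier → Permutation′ m
    bperm g = permutation (bact g) (bact (g ⁻¹)) (bact-inverseʳ g) (bact-inverseˡ g)

    ΓB-act : ∀ g {v j} → j ∈ ΓB v → bact g j ∈ ΓB (act g v)
    ΓB-act g j∈ = let (u , blk-u , adj) = to ∈-ΓB j∈ in
      from ∈-ΓB (act g u , trans (sym (blk-act g u)) (cong (bact g) blk-u) , preserves g _ u adj)

    ΓB-act⁻¹ : ∀ g {v j} → bact g j ∈ ΓB (act g v) → j ∈ ΓB v
    ΓB-act⁻¹ g {v} {j} gj∈ =
      subst₂ (λ v′ j′ → j′ ∈ ΓB v′) (act-inverseˡ g v) (bact-inverseˡ g j) (ΓB-act (g ⁻¹) gj∈)

    bimg-ΓB : ∀ g v → bimg g (ΓB v) ≡ ΓB (act g v)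
    bimg-ΓB g v = ⊆-antisym image⊆ ⊆image
      where
      image⊆ : bimg g (ΓB v) ⊆ ΓB (act g v)
      image⊆ j∈ = let (i , i∈ , gi≡j) = to ∈-bimg j∈ in subst (_∈ ΓB (act g v)) gi≡j (ΓB-act g i∈)
      ⊆image : ΓB (act g v) ⊆ bimg g (ΓB v)
      ⊆image {j} j∈ = from ∈-bimg
        (bact (g ⁻¹) j , ΓB-act⁻¹ g (subst (_∈ ΓB (act g v)) (sym (bact-inverseʳ g j)) j∈) ,
         bact-inverseʳ g j)

    starOf-act : ∀ g v → sact g (starOf v) ≡ starOf (act g v)
    starOf-act g v = cong₂ _,_ (blk-act g v) (bimg-ΓB g v)

    ΓB-size-act : ∀ g v → ∣ ΓB v ∣ ≡ ∣ ΓB (act g v) ∣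
    ΓB-size-act g v = size-permute (bperm g) (ΓB v) (ΓB (act g v)) (λ _ → mk⇔ (ΓB-act g) (ΓB-act⁻¹ g))

    fixes-blocks⇒fixes-stars : ∀ g → (∀ i → bact g i ≡ i) → ∀ v → starOf (act g v) ≡ starOf v
    fixes-blocks⇒fixes-stars g fixed v = begin
      starOf (act g v)               ≡⟨ starOf-act g v ⟨
      (bact g (blk v) , bimg g (ΓB v)) ≡⟨ cong₂ _,_ (fixed (blk v)) (⊆-antisym image⊆ ⊆image) ⟩
      starOf v                       ∎
      where
      open ≡-Reasoning
      image⊆ : bimg g (ΓB v) ⊆ ΓB v
      image⊆ j∈ = let (i , i∈ , gi≡j) = to ∈-bimg j∈ in
        subst (_∈ ΓB v) (trans (sym (fixed i)) gi≡j) i∈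
      ⊆image : ΓB v ⊆ bimg g (ΓB v)
      ⊆image {j} j∈ = from ∈-bimg (j , j∈ , fixed j)

    module Fibres (vtrans : VertexTransitive) where

      ΓB-size-constant : ∀ v w → ∣ ΓB v ∣ ≡ ∣ ΓB w ∣
      ΓB-size-constant v w = let (g , gv≡w) = vtrans v w in
        trans (ΓB-size-act g v) (cong (λ x → ∣ ΓB x ∣) gv≡w)

      ∈-Bsub⇔same-star : ∀ {v w} → w ∈ Bsub v ⇔ starOf w ≡ starOf v
      ∈-Bsub⇔same-star {v} {w} = mk⇔
        (λ w∈ → let (sameBlk , ⊆ΓB) = to ∈-Bsub w∈ in
                cong₂ _,_ sameBlk (sym (⊆-same-size ⊆ΓB (ΓB-size-constant v w))))
        (λ same → from ∈-Bsub (cong proj₁ same , λ {j} → subst (j ∈_) (sym (cong proj₂ same))))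

      Bsub-self : ∀ v → v ∈ Bsub v
      Bsub-self v = from ∈-Bsub⇔same-star refl

      Bsub-≡⇔same-star : ∀ {v w} → Bsub v ≡ Bsub w ⇔ starOf v ≡ starOf w
      Bsub-≡⇔same-star {v} {w} = mk⇔
        (λ same → to ∈-Bsub⇔same-star (subst (v ∈_) same (Bsub-self v)))
        (λ same → ⊆-antisym (λ x∈ → from ∈-Bsub⇔same-star (trans (to ∈-Bsub⇔same-star x∈) same))
                            (λ x∈ → from ∈-Bsub⇔same-star (trans (to ∈-Bsub⇔same-star x∈) (sym same))))

      fixes-blocks⇒fixes-Bsub : ∀ g → (∀ i → bact g i ≡ i) → ∀ v → vimg g (Bsub v) ≡ Bsub v
      fixes-blocks⇒fixes-Bsub g fixed v = ⊆-antisym image⊆ ⊆image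
        where
        image⊆ : vimg g (Bsub v) ⊆ Bsub v
        image⊆ w∈ = let (x , x∈ , gx≡w) = to ∈-vimg w∈ in
          from ∈-Bsub⇔same-star (subst (λ y → starOf y ≡ starOf v) gx≡w
            (trans (fixes-blocks⇒fixes-stars g fixed x) (to ∈-Bsub⇔same-star x∈)))
        ⊆image : Bsub v ⊆ vimg g (Bsub v)
        ⊆image {w} w∈ = from ∈-vimg (act (g ⁻¹) w , x∈ , act-inverseʳ g w)
          where
          x∈ : act (g ⁻¹) w ∈ Bsub v
          x∈ = from ∈-Bsub⇔same-star (begin
            starOf (act (g ⁻¹) w)            ≡⟨ fixes-blocks⇒fixes-stars g fixed _ ⟨
            starOf (act g (act (g ⁻¹) w))    ≡⟨ cong starOf (act-inverseʳ g w) ⟩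
            starOf w                         ≡⟨ to ∈-Bsub⇔same-star w∈ ⟩
            starOf v                         ∎)
            where open ≡-Reasoning

      fixes-Bsub⇒fixes-blocks : ∀ g → (∀ v → vimg g (Bsub v) ≡ Bsub v) → ∀ i → bact g i ≡ i
      fixes-Bsub⇒fixes-blocks g fixed i = trans (cong proj₁ same-star) (blk-rep i)
        where
        same-star : starOf (act g (rep i)) ≡ starOf (rep i)
        same-star = to ∈-Bsub⇔same-star
          (subst (act g (rep i) ∈_) (fixed (rep i)) (from ∈-vimg (rep i , Bsub-self (rep i) , refl)))

  module Claims (G : InG) where
    open InG G
    open Equivariance preserves invariant
    open Fibres vtrans

    -- A vertex exists: with no blocks, Γ would be a multicover vacuously.
    v₀ : Fin n
    v₀ = rep (inhabited-of-refuted notMulticover)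

    r : ℕ
    r = ∣ ΓB v₀ ∣

    ΓB-size : ∀ v → ∣ ΓB v ∣ ≡ r
    ΓB-size v = ΓB-size-constant v v₀

    starOf-IsStar : ∀ v → IsStar r (starOf v)
    starOf-IsStar v = ΓB⊆QN v , ΓB-size v

    -- Arc-transitivity makes the stabiliser of v transitive on Γ_B(v).
    starOf-symmetric : ∀ v → SymmetricStar (starOf v)
    starOf-symmetric v σ σ′ σ∈ σ′∈ with to ∈-ΓB σ∈ | to ∈-ΓB σ′∈
    ... | u , refl , vu | u′ , refl , vu′ =
      let (g , gv≡v , gu≡u′) = arctrans v u v u′ vu vu′ in
      g , trans (blk-act g v) (cong blk gv≡v)
        , trans (bimg-ΓB g v) (cong ΓB gv≡v)
        , trans (blk-act g u) (cong blk gu≡u′)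

    𝓢-symmetric : XSymStars r 𝓢
    𝓢-symmetric =
      ( (λ { _ (v , refl) → starOf-IsStar v })
      , (starOf v₀ , v₀ , refl)
      , (λ { g _ (v , refl) → act g v , starOf-act g v })
      , (λ { _ _ (v , refl) (w , refl) → let (g , gv≡w) = vtrans v w in
                                          g , trans (starOf-act g v) (cong starOf gv≡w) }) )
      , (starOf v₀ , (v₀ , refl) , starOf-symmetric v₀)

    -- Γ has an arc, since Γ_B has valency at least 2.
    an-arc : ∃ λ u → ∃ λ w → Adj u w
    an-arc =
      let (j , j∈) = nonempty-of-size (QN (blk v₀)) (ℕ.<-≤-trans (s≤s z≤n) (val≥2 (blk v₀)))
          (u , w , _ , _ , uw) = to ∈-QN j∈
      in u , w , uw

    -- Hence, by vertex-transitivity, every vertex has a neighbour.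
    neighbour : ∀ v → ∃ λ u → Adj v u
    neighbour v = let (a , b , ab) = an-arc ; (g , ga≡v) = vtrans a v in
      act g b , subst (λ x → Adj x (act g b)) ga≡v (preserves g a b ab)

    St-Θ₀⇔𝓢 : ∀ s → StOf Θ₀ s ⇔ 𝓢 s
    St-Θ₀⇔𝓢 s = mk⇔ St⇒𝓢 𝓢⇒St
      where
      St⇒𝓢 : StOf Θ₀ s → 𝓢 s
      St⇒𝓢 (_ , inj₁ (v , _ , _ , s≡ , _)) = v , s≡
      St⇒𝓢 (_ , inj₂ (_ , u , _ , _ , s≡)) = u , s≡
      𝓢⇒St : 𝓢 s → StOf Θ₀ s
      𝓢⇒St (v , s≡) = let (u , vu) = neighbour v in starOf u , inj₁ (v , u , vu , s≡ , refl)

    arc-IsDStar : ∀ {v u} → Adj v u → IsDStar r (starOf v , starOf u)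
    arc-IsDStar {v} {u} vu =
      starOf-IsStar v , starOf-IsStar u ,
      from ∈-ΓB (u , refl , vu) , from ∈-ΓB (v , refl , adj-sym vu)

    Θ₀-symmetric : XSymDOrbit r Θ₀
    Θ₀-symmetric =
      ( (λ { _ (v , u , vu , refl , refl) → arc-IsDStar vu })
      , (let (a , b , ab) = an-arc in (starOf a , starOf b) , a , b , ab , refl , refl)
      , (λ { g _ (v , u , vu , refl , refl) →
               act g v , act g u , preserves g v u vu , starOf-act g v , starOf-act g u })
      , (λ { _ _ (v , u , vu , refl , refl) (v′ , u′ , vu′ , refl , refl) →
               let (g , gv≡v′ , gu≡u′) = arctrans v u v′ u′ vu vu′ in
               g , cong₂ _,_ (trans (starOf-act g v) (cong starOf gv≡v′))
                             (trans (starOf-act g u) (cong starOf gu≡u′)) }) )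
      , XSymStars-cong (λ s → ⇔-sym (St-Θ₀⇔𝓢 s)) 𝓢-symmetric

    Θ₀-self-paired : SelfPaired Θ₀
    Θ₀-self-paired _ _ (v , u , vu , l≡ , r≡) = u , v , adj-sym vu , r≡ , l≡

    ΓuB≅Π : Iso ΓuB (ΠGraph Θ₀)
    ΓuB≅Π = record
      { f     = λ v → starOf v , from (St-Θ₀⇔𝓢 (starOf v)) (v , refl)
      ; f-≈   = to Bsub-≡⇔same-star
      ; f-inj = from Bsub-≡⇔same-star
      ; f-sur = λ (s , st) → let (v , s≡) = to (St-Θ₀⇔𝓢 s) st in v , sym s≡
      ; f-∼   = λ v w → mk⇔ (edge⇒Θ₀ v w) (Θ₀⇒edge v w)
      }
      where
      edge⇒Θ₀ : ∀ v w → (∃ λ x → ∃ λ y → x ∈ Bsub v × y ∈ Bsub w × Adj x y) →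
                Θ₀ (starOf v , starOf w)
      edge⇒Θ₀ v w (x , y , x∈ , y∈ , xy) =
        x , y , xy , sym (to ∈-Bsub⇔same-star x∈) , sym (to ∈-Bsub⇔same-star y∈)
      Θ₀⇒edge : ∀ v w → Θ₀ (starOf v , starOf w) →
                (∃ λ x → ∃ λ y → x ∈ Bsub v × y ∈ Bsub w × Adj x y)
      Θ₀⇒edge v w (x , y , xy , v≡ , w≡) =
        x , y , from ∈-Bsub⇔same-star (sym v≡) , from ∈-Bsub⇔same-star (sym w≡) , xy

    faithful-B⇔faithful-B̲ : FaithfulOnB ⇔ FaithfulOnUB
    faithful-B⇔faithful-B̲ = mk⇔
      (λ faithfulB g fixed → faithfulB g (fixes-Bsub⇒fixes-blocks g fixed))
      (λ faithfulB̲ g fixed → faithfulB̲ g (fixes-blocks⇒fixes-Bsub g fixed))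

theorem3p7 : {c ℓ : Level} {n m : ℕ} (Γ : Graph n) (X : Group c ℓ) (A : Action X n) (P : Partition n m) →
    let open Setup Γ X A P in
    InG →
    (Σ ℕ λ r →
       (∀ v → ∣ ΓB v ∣ ≡ r) ×
       XSymStars r 𝓢 ×
       XSymDOrbit r Θ₀ ×
       SelfPaired Θ₀ ×
       (∀ s → StOf Θ₀ s ⇔ 𝓢 s) ×
       Iso ΓuB (ΠGraph Θ₀)) ×
    (FaithfulOnB ⇔ FaithfulOnUB)
theorem3p7 Γ X A P G =
  (r , ΓB-size , 𝓢-symmetric , Θ₀-symmetric , Θ₀-self-paired , St-Θ₀⇔𝓢 , ΓuB≅Π) ,
  faithful-B⇔faithful-B̲
  where open Theory.Claims Γ X A P G
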